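{- Let $G$ be a finite simple graph and let $a,b,c,d$ be four distinct vertices of $G$ such that $ac, bd \in E(G)$ and $ad, bc \notin E(G)$. Let $\otimes^{ac}_{bd}G = G - ac - bd + ad + bc$. If $v$ is a vertex with $v \notin \{a,b,c,d\}$ and the card $G - v$ is ds-completable, then the card $(\otimes^{ac}_{bd}G) - v$ is ds-completable.
   Context: For a vertex $v$ of a graph $G$, the card $G-v$ is the vertex-deleted subgraph. The card $G-v$ is called ds-completable if, for each integer $d$, the vertices having degree $d$ in $G-v$ are either all neighbours of $v$ in $G$ or all non-neighbours of $v$ in $G$. The operation $\otimes^{ac}_{bd}$ is called a switch. -}

module Defs where

open import Data.Nat using (ℕ)
open import Data.Fin using (Fin; _≟_)
open import Data.Sum using (_⊎_)
open import Data.Bool using (Bool; true; false; _∧_; _∨_; if_then_else_; not)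
open import Data.List using (List; filterᵇ; length)
open import Data.List.Base using (allFin)
open import Relation.Nullary using (¬_)
open import Relation.Nullary.Decidable using (⌊_⌋)
open import Relation.Binary.PropositionalEquality using (_≡_)

Adj : ℕ → Set
Adj n = Fin n → Fin n → Bool

record IsSimple {n : ℕ} (E : Adj n) : Set where
  field
    symm    : ∀ x y → E x y ≡ E y x
    loopless : ∀ x → E x x ≡ false

_==_ : ∀ {n} → Fin n → Fin n → Bool
x == y = ⌊ x ≟ y ⌋

isPair : ∀ {n} → Fin n → Fin n → Fin n → Fin n → Bool
isPair p q x y = ((x == p) ∧ (y == q)) ∨ ((x == q) ∧ (y == p))

switch : ∀ {n} → Fin n → Fin n → Fin n → Fin n → Adj n → Adj n
switch a b c d E x y =
  if isPair a c x y ∨ isPair b d x y then false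
  else if isPair a d x y ∨ isPair b c x y then true
  else E x y

degCard : ∀ {n} → Adj n → Fin n → Fin n → ℕ
degCard {n} E v w = length (filterᵇ (λ u → not (u == v) ∧ E u w) (allFin n))

DsCompletable : ∀ {n} → Adj n → Fin n → Set
DsCompletable {n} E v =
  ∀ (d : ℕ) →
    (∀ (x : Fin n) → ¬ (x ≡ v) → degCard E v x ≡ d → E v x ≡ true)
    ⊎
    (∀ (x : Fin n) → ¬ (x ≡ v) → degCard E v x ≡ d → E v x ≡ false)

module Submission where

-- The switch ⊗^{ac}_{bd} only changes the four pairs ac, bd, ad, bc.
--   (1) Since v ∉ {a,b,c,d}, the neighbourhood of v is unchanged.
--   (2) Every degree in the card G - v is unchanged: a vertex outside {a,b,c,d}
--       meets no changed pair, while each of a, b, c, d trades exactly one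
--       neighbour for another (a: c ↦ d, b: d ↦ c, c: a ↦ b, d: b ↦ a), and
--       neither of them is v.
--   (3) Whether G - v is ds-completable depends only on the degrees in the
--       card and the neighbourhood of v, so it transfers from G to ⊗G.

open import Defs
open import Data.Nat using (ℕ; suc; _+_)
open import Data.Nat.Properties using (+-cancelʳ-≡; +-commutativeSemigroup)
open import Data.Fin using (Fin; _≟_) renaming (zero to fzero; suc to fsuc)
open import Data.Bool using (Bool; true; false; _∧_; _∨_; if_then_else_; not)
open import Data.Bool.Properties using (∨-comm)
open import Data.List using (List; []; _∷_; map; filterᵇ; length; tabulate; allFin)
open import Data.List.Properties using (map-tabulate)
open import Data.Product using (_×_; _,_)
open import Data.Sum using (inj₁; inj₂)
open import Data.Empty using (⊥-elim)
open import Function using (_∘_)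
open import Relation.Nullary using (¬_; Dec; yes; no)
open import Relation.Nullary.Decidable using (dec-true; dec-false; isYes≗does; ⌊⌋-map′)
open import Relation.Binary.PropositionalEquality
open import Algebra.Properties.CommutativeSemigroup +-commutativeSemigroup
  using (interchange)

ind : Bool → ℕ
ind true  = 1
ind false = 0

countᵇ : ∀ {A : Set} → (A → Bool) → List A → ℕ
countᵇ p xs = length (filterᵇ p xs)

countᵇ-∷ : ∀ {A : Set} (p : A → Bool) x xs →
           countᵇ p (x ∷ xs) ≡ ind (p x) + countᵇ p xs
countᵇ-∷ p x xs with p x
... | true  = refl
... | false = refl

countᵇ-cong : ∀ {A : Set} {p q : A → Bool} → (∀ u → p u ≡ q u) →
              ∀ xs → countᵇ p xs ≡ countᵇ q xs
countᵇ-cong p≗q []       = refl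
countᵇ-cong {p = p} {q} p≗q (x ∷ xs) rewrite countᵇ-∷ p x xs | countᵇ-∷ q x xs
  = cong₂ _+_ (cong ind (p≗q x)) (countᵇ-cong p≗q xs)

countᵇ-map : ∀ {A B : Set} (p : B → Bool) (f : A → B) xs →
             countᵇ p (map f xs) ≡ countᵇ (p ∘ f) xs
countᵇ-map p f []       = refl
countᵇ-map p f (x ∷ xs) rewrite countᵇ-∷ p (f x) (map f xs) | countᵇ-∷ (p ∘ f) x xs
  = cong (ind (p (f x)) +_) (countᵇ-map p f xs)

countᵇ-balance : ∀ {A : Set} (p q r s : A → Bool) →
                 (∀ u → ind (p u) + ind (q u) ≡ ind (r u) + ind (s u)) →
                 ∀ xs → countᵇ p xs + countᵇ q xs ≡ countᵇ r xs + countᵇ s xs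
countᵇ-balance p q r s balanced [] = refl
countᵇ-balance p q r s balanced (x ∷ xs)
  rewrite countᵇ-∷ p x xs | countᵇ-∷ q x xs | countᵇ-∷ r x xs | countᵇ-∷ s x xs
  = begin
    (ind (p x) + countᵇ p xs) + (ind (q x) + countᵇ q xs)
      ≡⟨ interchange (ind (p x)) (countᵇ p xs) (ind (q x)) (countᵇ q xs) ⟩
    (ind (p x) + ind (q x)) + (countᵇ p xs + countᵇ q xs)
      ≡⟨ cong₂ _+_ (balanced x) (countᵇ-balance p q r s balanced xs) ⟩
    (ind (r x) + ind (s x)) + (countᵇ r xs + countᵇ s xs)
      ≡⟨ interchange (ind (r x)) (ind (s x)) (countᵇ r xs) (countᵇ s xs) ⟩
    (ind (r x) + countᵇ r xs) + (ind (s x) + countᵇ s xs)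
      ∎
  where open ≡-Reasoning

countᵇ-none : ∀ {A : Set} (p : A → Bool) → (∀ u → p u ≡ false) → ∀ xs → countᵇ p xs ≡ 0
countᵇ-none p never []       = refl
countᵇ-none p never (x ∷ xs) rewrite countᵇ-∷ p x xs | never x = countᵇ-none p never xs

==-refl : ∀ {n} (x : Fin n) → (x == x) ≡ true
==-refl x = trans (isYes≗does (x ≟ x)) (dec-true (x ≟ x) refl)

==-false : ∀ {n} {x y : Fin n} → ¬ x ≡ y → (x == y) ≡ false
==-false {x = x} {y} x≢y = trans (isYes≗does (x ≟ y)) (dec-false (x ≟ y) x≢y)

==-fsuc : ∀ {n} (x y : Fin n) → (fsuc x == fsuc y) ≡ (x == y)
==-fsuc x y = ⌊⌋-map′ _ _ (x ≟ y)

countᵇ-allFin-suc : ∀ {n} (p : Fin (suc n) → Bool) →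
                    countᵇ p (allFin (suc n)) ≡ ind (p fzero) + countᵇ (p ∘ fsuc) (allFin n)
countᵇ-allFin-suc {n} p = begin
  countᵇ p (allFin (suc n))                        ≡⟨ countᵇ-∷ p fzero (tabulate fsuc) ⟩
  ind (p fzero) + countᵇ p (tabulate fsuc)         ≡⟨ cong (λ xs → ind (p fzero) + countᵇ p xs)
                                                         (sym (map-tabulate {n = n} (λ j → j) fsuc)) ⟩
  ind (p fzero) + countᵇ p (map fsuc (allFin n))   ≡⟨ cong (ind (p fzero) +_) (countᵇ-map p fsuc (allFin n)) ⟩
  ind (p fzero) + countᵇ (p ∘ fsuc) (allFin n)     ∎
  where open ≡-Reasoning

occurs-once : ∀ {n} (s : Fin n) → countᵇ (_== s) (allFin n) ≡ 1
occurs-once {suc n} fzero =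
  trans (countᵇ-allFin-suc {n} (_== fzero))
        (cong suc (countᵇ-none (λ j → fsuc j == fzero) (λ _ → refl) (allFin n)))
occurs-once {suc n} (fsuc t) = begin
  countᵇ (_== fsuc t) (allFin (suc n))        ≡⟨ countᵇ-allFin-suc {n} (_== fsuc t) ⟩
  countᵇ (λ j → fsuc j == fsuc t) (allFin n)  ≡⟨ countᵇ-cong (λ j → ==-fsuc j t) (allFin n) ⟩
  countᵇ (_== t) (allFin n)                   ≡⟨ occurs-once t ⟩
  1                                           ∎
  where open ≡-Reasoning

countᵇ-exchange : ∀ {n} (p q : Fin n → Bool) (r t : Fin n) → ¬ r ≡ t →
                  p r ≡ true → q r ≡ false → p t ≡ false → q t ≡ true →
                  (∀ u → ¬ u ≡ r → ¬ u ≡ t → q u ≡ p u) →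
                  countᵇ q (allFin n) ≡ countᵇ p (allFin n)
countᵇ-exchange {n} p q r t r≢t pr qr pt qt elsewhere =
  +-cancelʳ-≡ 1 _ _ (begin
    countᵇ q (allFin n) + 1                       ≡⟨ cong (countᵇ q (allFin n) +_) (sym (occurs-once r)) ⟩
    countᵇ q (allFin n) + countᵇ (_== r) (allFin n) ≡⟨ countᵇ-balance _ _ _ _ balanced (allFin n) ⟩
    countᵇ p (allFin n) + countᵇ (_== t) (allFin n) ≡⟨ cong (countᵇ p (allFin n) +_) (occurs-once t) ⟩
    countᵇ p (allFin n) + 1                       ∎)
  where
  open ≡-Reasoning
  balanced-at : ∀ u → Dec (u ≡ r) → Dec (u ≡ t) →
                ind (q u) + ind (u == r) ≡ ind (p u) + ind (u == t)
  balanced-at u (yes refl) _ rewrite qr | pr | ==-refl r | ==-false r≢t = refl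
  balanced-at u (no u≢r) (yes refl) rewrite qt | pt | ==-refl t | ==-false u≢r = refl
  balanced-at u (no u≢r) (no u≢t)
    rewrite elsewhere u u≢r u≢t | ==-false u≢r | ==-false u≢t = refl

  balanced : ∀ u → ind (q u) + ind (u == r) ≡ ind (p u) + ind (u == t)
  balanced u = balanced-at u (u ≟ r) (u ≟ t)

degCard-cong : ∀ {n} (E F : Adj n) (v w : Fin n) → (∀ u → F u w ≡ E u w) →
               degCard F v w ≡ degCard E v w
degCard-cong {n} E F v w same =
  countᵇ-cong (λ u → cong (not (u == v) ∧_) (same u)) (allFin n)

degCard-exchange : ∀ {n} (E F : Adj n) (v w r t : Fin n) →
                   ¬ r ≡ t → ¬ r ≡ v → ¬ t ≡ v →
                   E r w ≡ true → F r w ≡ false → E t w ≡ false → F t w ≡ true →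
                   (∀ u → ¬ u ≡ r → ¬ u ≡ t → F u w ≡ E u w) →
                   degCard F v w ≡ degCard E v w
degCard-exchange E F v w r t r≢t r≢v t≢v Erw Frw Etw Ftw elsewhere =
  countᵇ-exchange (inCard E) (inCard F) r t r≢t
    (cong₂ _∧_ (cong not (==-false r≢v)) Erw) (cong₂ _∧_ (cong not (==-false r≢v)) Frw)
    (cong₂ _∧_ (cong not (==-false t≢v)) Etw) (cong₂ _∧_ (cong not (==-false t≢v)) Ftw)
    (λ u u≢r u≢t → cong (not (u == v) ∧_) (elsewhere u u≢r u≢t))
  where
  inCard : Adj _ → Fin _ → Bool
  inCard G u = not (u == v) ∧ G u w

dsCompletable-transfer : ∀ {n} (E F : Adj n) (v : Fin n) →
                         (∀ x → F v x ≡ E v x) → (∀ w → degCard F v w ≡ degCard E v w) →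
                         DsCompletable E v → DsCompletable F v
dsCompletable-transfer E F v sameRow sameDeg dsE k with dsE k
... | inj₁ allAdj    = inj₁ (λ x x≢v deg → trans (sameRow x) (allAdj x x≢v (trans (sym (sameDeg x)) deg)))
... | inj₂ allNonAdj = inj₂ (λ x x≢v deg → trans (sameRow x) (allNonAdj x x≢v (trans (sym (sameDeg x)) deg)))

isPair-sym : ∀ {n} (p q x y : Fin n) → isPair p q x y ≡ isPair q p x y
isPair-sym p q x y = ∨-comm ((x == p) ∧ (y == q)) ((x == q) ∧ (y == p))

isPair-swapped : ∀ {n} (p q : Fin n) → isPair p q q p ≡ true
isPair-swapped p q rewrite ==-refl q | ==-refl p = ∨-comm _ true

both-false : ∀ {n} {p q x y : Fin n} → ¬ (x ≡ p × y ≡ q) → (x == p) ∧ (y == q) ≡ false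
both-false {p = p} {q} {x} {y} ¬both with x ≟ p | y ≟ q
... | yes refl | yes refl = ⊥-elim (¬both (refl , refl))
... | yes _    | no _     = refl
... | no _     | _        = refl

isPair-false : ∀ {n} {p q : Fin n} (x y : Fin n) → ¬ (x ≡ p × y ≡ q) → ¬ (x ≡ q × y ≡ p) →
               isPair p q x y ≡ false
isPair-false {p = p} {q} x y ¬pq ¬qp =
  cong₂ _∨_ (both-false {p = p} {q} {x} {y} ¬pq) (both-false {p = q} {p} {x} {y} ¬qp)

isPair-false-left : ∀ {n} {p q x y : Fin n} → ¬ x ≡ p → ¬ x ≡ q → isPair p q x y ≡ false
isPair-false-left {x = x} {y} x≢p x≢q = isPair-false x y (λ (x≡p , _) → x≢p x≡p) (λ (x≡q , _) → x≢q x≡q)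

isPair-false-right : ∀ {n} {p q x y : Fin n} → ¬ y ≡ p → ¬ y ≡ q → isPair p q x y ≡ false
isPair-false-right {x = x} {y} y≢p y≢q = isPair-false x y (λ (_ , y≡q) → y≢q y≡q) (λ (_ , y≡p) → y≢p y≡p)

switch-by : Bool → Bool → Bool → Bool
switch-by removed added old = if removed then false else if added then true else old

module _ {n : ℕ} (E : Adj n) (a b c d x y : Fin n) where

  switch-removed : isPair a c x y ≡ true → switch a b c d E x y ≡ false
  switch-removed ac rewrite ac = refl

  switch-added : isPair a c x y ≡ false → isPair b d x y ≡ false → isPair a d x y ≡ true →
                 switch a b c d E x y ≡ true
  switch-added ac bd ad rewrite ac | bd | ad = refl

  switch-kept : isPair a c x y ≡ false → isPair b d x y ≡ false →
                isPair a d x y ≡ false → isPair b c x y ≡ false →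
                switch a b c d E x y ≡ E x y
  switch-kept ac bd ad bc rewrite ac | bd | ad | bc = refl

  switch-sym-cdab : switch c d a b E x y ≡ switch a b c d E x y
  switch-sym-cdab = cong₂ (λ removed added → switch-by removed added (E x y))
    (cong₂ _∨_ (isPair-sym c a x y) (isPair-sym d b x y))
    (trans (cong₂ _∨_ (isPair-sym c b x y) (isPair-sym d a x y))
           (∨-comm (isPair b c x y) (isPair a d x y)))

  switch-sym-badc : switch b a d c E x y ≡ switch a b c d E x y
  switch-sym-badc = cong₂ (λ removed added → switch-by removed added (E x y))
    (∨-comm (isPair b d x y) (isPair a c x y)) (∨-comm (isPair b c x y) (isPair a d x y))

switch-row : ∀ {n} (E : Adj n) (a b c d v : Fin n) →
             ¬ v ≡ a → ¬ v ≡ b → ¬ v ≡ c → ¬ v ≡ d →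
             ∀ x → switch a b c d E v x ≡ E v x
switch-row E a b c d v v≢a v≢b v≢c v≢d x = switch-kept E a b c d v x
  (isPair-false-left {y = x} v≢a v≢c) (isPair-false-left {y = x} v≢b v≢d)
  (isPair-false-left {y = x} v≢a v≢d) (isPair-false-left {y = x} v≢b v≢c)

switch-degree-outside : ∀ {n} (E : Adj n) (a b c d v w : Fin n) →
                        ¬ w ≡ a → ¬ w ≡ b → ¬ w ≡ c → ¬ w ≡ d →
                        degCard (switch a b c d E) v w ≡ degCard E v w
switch-degree-outside E a b c d v w w≢a w≢b w≢c w≢d =
  degCard-cong E (switch a b c d E) v w (λ u → switch-kept E a b c d u w
    (isPair-false-right {x = u} w≢a w≢c) (isPair-false-right {x = u} w≢b w≢d)
    (isPair-false-right {x = u} w≢a w≢d) (isPair-false-right {x = u} w≢b w≢c))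

-- The vertex a trades its neighbour c for d, so it keeps its degree in G - v.
switch-degree-first : ∀ {n} (E : Adj n) (a b c d v : Fin n) →
                      ¬ a ≡ b → ¬ a ≡ c → ¬ a ≡ d → ¬ c ≡ d → ¬ c ≡ v → ¬ d ≡ v →
                      E c a ≡ true → E d a ≡ false →
                      degCard (switch a b c d E) v a ≡ degCard E v a
switch-degree-first E a b c d v a≢b a≢c a≢d c≢d c≢v d≢v Eca Eda =
  degCard-exchange E (switch a b c d E) v a c d c≢d c≢v d≢v Eca
    (switch-removed E a b c d c a (isPair-swapped a c)) Eda
    (switch-added E a b c d d a
      (isPair-false d a (λ (_ , a≡c) → a≢c a≡c) (λ (d≡c , _) → c≢d (sym d≡c)))
      (isPair-false d a (λ (_ , a≡d) → a≢d a≡d) (λ (_ , a≡b) → a≢b a≡b))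
      (isPair-swapped a d))
    kept
  where
  kept : ∀ u → ¬ u ≡ c → ¬ u ≡ d → switch a b c d E u a ≡ E u a
  kept u u≢c u≢d = switch-kept E a b c d u a
    (isPair-false u a (λ (_ , a≡c) → a≢c a≡c) (λ (u≡c , _) → u≢c u≡c))
    (isPair-false u a (λ (_ , a≡d) → a≢d a≡d) (λ (u≡d , _) → u≢d u≡d))
    (isPair-false u a (λ (_ , a≡d) → a≢d a≡d) (λ (u≡d , _) → u≢d u≡d))
    (isPair-false u a (λ (_ , a≡c) → a≢c a≡c) (λ (u≡c , _) → u≢c u≡c))

-- The switch preserves every degree of the card G - v, for v ∉ {a,b,c,d}:
-- a, b, c, d each trade one neighbour (via the symmetries of the switch,
-- each case is an instance of switch-degree-first), all other vertices see no change.
switch-degree : ∀ {n} (E : Adj n) → (∀ x y → E x y ≡ E y x) →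
                (a b c d : Fin n) →
                ¬ a ≡ b → ¬ a ≡ c → ¬ a ≡ d → ¬ b ≡ c → ¬ b ≡ d → ¬ c ≡ d →
                E a c ≡ true → E b d ≡ true → E a d ≡ false → E b c ≡ false →
                (v : Fin n) → ¬ v ≡ a → ¬ v ≡ b → ¬ v ≡ c → ¬ v ≡ d →
                ∀ w → degCard (switch a b c d E) v w ≡ degCard E v w
switch-degree E symm a b c d a≢b a≢c a≢d b≢c b≢d c≢d Eac Ebd Ead Ebc v v≢a v≢b v≢c v≢d w =
  degree-at w (w ≟ a) (w ≟ b) (w ≟ c) (w ≟ d)
  where
  S : Adj _
  S = switch a b c d E

  via : ∀ {G : Adj _} x → (∀ y z → G y z ≡ S y z) →
        degCard G v x ≡ degCard E v x → degCard S v x ≡ degCard E v x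
  via {G} x same = trans (degCard-cong G S v x (λ u → sym (same u x)))

  degree-at : ∀ x → Dec (x ≡ a) → Dec (x ≡ b) → Dec (x ≡ c) → Dec (x ≡ d) →
              degCard S v x ≡ degCard E v x
  degree-at x (yes refl) _ _ _ = switch-degree-first E a b c d v a≢b a≢c a≢d c≢d
        (≢-sym v≢c) (≢-sym v≢d) (trans (symm c a) Eac) (trans (symm d a) Ead)
  degree-at x (no _) (yes refl) _ _ = via b (switch-sym-badc E a b c d)
        (switch-degree-first E b a d c v (≢-sym a≢b) b≢d b≢c (≢-sym c≢d)
          (≢-sym v≢d) (≢-sym v≢c) (trans (symm d b) Ebd) (trans (symm c b) Ebc))
  degree-at x (no _) (no _) (yes refl) _ = via c (switch-sym-cdab E a b c d)
        (switch-degree-first E c d a b v c≢d (≢-sym a≢c) (≢-sym b≢c) a≢b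
          (≢-sym v≢a) (≢-sym v≢b) Eac Ebc)
  degree-at x (no _) (no _) (no _) (yes refl) =
        via d (λ y z → trans (switch-sym-cdab E b a d c y z) (switch-sym-badc E a b c d y z))
        (switch-degree-first E d c b a v (≢-sym c≢d) (≢-sym b≢d) (≢-sym a≢d) (≢-sym a≢b)
          (≢-sym v≢b) (≢-sym v≢a) Ebd Ead)
  degree-at x (no x≢a) (no x≢b) (no x≢c) (no x≢d) =
    switch-degree-outside E a b c d v x x≢a x≢b x≢c x≢d

lemma2 : ∀ {n : ℕ} (E : Adj n) → IsSimple E →
    (a b c d : Fin n) →
    ¬ (a ≡ b) → ¬ (a ≡ c) → ¬ (a ≡ d) → ¬ (b ≡ c) → ¬ (b ≡ d) → ¬ (c ≡ d) →
    E a c ≡ true → E b d ≡ true → E a d ≡ false → E b c ≡ false →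
    (v : Fin n) → ¬ (v ≡ a) → ¬ (v ≡ b) → ¬ (v ≡ c) → ¬ (v ≡ d) →
    DsCompletable E v → DsCompletable (switch a b c d E) v
lemma2 E simple a b c d a≢b a≢c a≢d b≢c b≢d c≢d Eac Ebd Ead Ebc v v≢a v≢b v≢c v≢d =
  dsCompletable-transfer E (switch a b c d E) v
    (switch-row E a b c d v v≢a v≢b v≢c v≢d)
    (switch-degree E (IsSimple.symm simple) a b c d a≢b a≢c a≢d b≢c b≢d c≢d
      Eac Ebd Ead Ebc v v≢a v≢b v≢c v≢d)
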